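{- For $n\ge 4$ and $k\ge 0$, the number of independent sets of size $k$ of $\Gamma_{D_n}$ is $$i_k(\Gamma_{D_n})=\binom{n-k}{k-2}+\binom{n-k-1}{k-1}+\binom{n-k}{k}.$$
   Context: $\Gamma_{D_n}$ is the graph on vertices $s_1,\ldots,s_{n-2},s_{n-1},s'_{n-1}$ with edges $s_is_{i+1}$ for $1\le i\le n-2$ and $s_{n-2}s'_{n-1}$ (a path $s_1-\cdots-s_{n-2}$ with two leaves attached to $s_{n-2}$). Binomial coefficients $\binom{a}{b}$ are taken to be $0$ unless $0\le b\le a$. -}

module Defs where

open import Data.Nat using (ℕ; zero; suc; _+_; _∸_; _<ᵇ_; _≤_)
open import Data.Nat.Combinatorics using (_C_)
open import Data.Integer using (ℤ; +_; -[1+_]; _-_)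
open import Data.Bool using (Bool; true; false; _∧_; not; if_then_else_)
open import Data.Fin using (Fin; toℕ)
open import Data.Fin.Subset using (Subset; _∈_; ∣_∣)
open import Data.Vec using (Vec; []; _∷_; lookup)
open import Data.List using (List; []; _∷_; map; _++_; length; filter)
open import Relation.Binary.PropositionalEquality using (_≡_)
open import Relation.Nullary using (¬_; Dec)
open import Data.Product using (_×_)
open import Data.Sum using (_⊎_)

-- Binomial coefficient with integer arguments, 0 unless 0 ≤ b ≤ a
-- (for naturals, stdlib's a C b is already 0 when b > a).
binomℤ : ℤ → ℤ → ℕ
binomℤ (+ a) (+ b) = a C b
binomℤ (+ a) -[1+ _ ] = 0
binomℤ -[1+ _ ] _ = 0

-- Γ_{D_n} on vertex set Fin n:
--   vertex i (0 ≤ i ≤ n-3) is s_{i+1};  vertex n-2 is s_{n-1};  vertex n-1 is s'_{n-1}.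
-- Edges: s_i s_{i+1} for 1 ≤ i ≤ n-2, and s_{n-2} s'_{n-1}.
edgeℕ : ℕ → ℕ → ℕ → Set
edgeℕ n a b = (suc a ≡ b × suc b ≤ n ∸ 1)
  ⊎ (a ≡ n ∸ 3 × b ≡ n ∸ 1)

Adj : (n : ℕ) → Fin n → Fin n → Set
Adj n u v = edgeℕ n (toℕ u) (toℕ v) ⊎ edgeℕ n (toℕ v) (toℕ u)

Independent : (n : ℕ) → Subset n → Set
Independent n S = ∀ u v → u ∈ S → v ∈ S → ¬ Adj n u v

allSubsets : (n : ℕ) → List (Subset n)
allSubsets zero = [] ∷ []
allSubsets (suc n) = map (true ∷_) (allSubsets n) ++ map (false ∷_) (allSubsets n)

-- number of independent sets of size k of Γ_{D_n}, computed with any decision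
-- procedure for the predicate (the count does not depend on the procedure)
iCount : (n k : ℕ) → (dec : (S : Subset n) → Dec (Independent n S × ∣ S ∣ ≡ k)) → ℕ
iCount n k dec = length (filter dec (allSubsets n))

-- Deleting the end vertex s₁ of Γ_{D(n+2)} gives i_k(D_{n+2}) = i_{k-1}(D_n) + i_k(D_{n+1}):
-- an independent set either avoids s₁, or contains s₁ and hence avoids s₂.  Each of the
-- three binomial terms satisfies the same recurrence by Pascal's rule along a diagonal,
-- and the formula holds for n = 3 and n = 4 by direct computation.

module Submission where

open import Level using (0ℓ)
open import Function using (_∘_)
open import Defs
open import Data.Bool using (true; false)
open import Data.Nat using (ℕ; zero; suc; _+_; _∸_; _≤_; _≟_; _≤?_; z≤n; s≤s)
open import Data.Nat.Properties using (suc-injective)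
open import Data.Nat.Combinatorics using (_C_; nCk+nC[k+1]≡[n+1]C[k+1])
import Data.Nat.Tactic.RingSolver as ℕ-Solver
open import Data.Integer using (+_; -[1+_]; _-_; 1ℤ) renaming (suc to sucℤ; _+_ to _+ℤ_)
open import Data.Integer.Tactic.RingSolver using (solve-∀)
open import Data.Fin using (Fin; zero; suc; toℕ)
open import Data.Fin.Properties using (all?; toℕ-injective)
open import Data.Fin.Subset using (Subset; _∈_; ∣_∣)
open import Data.Fin.Subset.Properties using (_∈?_)
open import Data.Vec using (_∷_; here; there)
open import Data.List using (List; []; _∷_; _++_; length; filter; map)
open import Data.List.Properties using (length-++; filter-++; filter-≐; filter-none)
open import Data.List.Relation.Unary.All using (universal)
open import Data.Empty using (⊥-elim)
open import Data.Product using (_×_; _,_)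
open import Data.Sum using (inj₁; inj₂)
open import Relation.Nullary using (Dec; ¬_; ¬?; does)
open import Relation.Nullary.Decidable using (_×-dec_; _⊎-dec_; _→-dec_)
open import Relation.Unary using (Pred; Decidable; _≐_)
open import Relation.Binary.PropositionalEquality using (_≡_; refl; sym; trans; cong; cong₂; module ≡-Reasoning)

length-filter-map : ∀ {A B : Set} {P : Pred B 0ℓ} (P? : Decidable P) (f : A → B) (xs : List A) →
  length (filter P? (map f xs)) ≡ length (filter (P? ∘ f) xs)
length-filter-map P? f [] = refl
length-filter-map P? f (x ∷ xs) with does (P? (f x))
... | true  = cong suc (length-filter-map P? f xs)
... | false = length-filter-map P? f xs

countSubsets : ∀ {n} {P : Pred (Subset n) 0ℓ} → Decidable P → ℕ
countSubsets {n} P? = length (filter P? (allSubsets n))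

countSubsets-∷ : ∀ {n} {P : Pred (Subset (suc n)) 0ℓ} (P? : Decidable P) →
  countSubsets P? ≡ countSubsets (P? ∘ (true ∷_)) + countSubsets (P? ∘ (false ∷_))
countSubsets-∷ {n} P? = begin
  length (filter P? (map (true ∷_) Sₙ ++ map (false ∷_) Sₙ))
    ≡⟨ cong length (filter-++ P? (map (true ∷_) Sₙ) _) ⟩
  length (filter P? (map (true ∷_) Sₙ) ++ filter P? (map (false ∷_) Sₙ))
    ≡⟨ length-++ (filter P? (map (true ∷_) Sₙ)) ⟩
  length (filter P? (map (true ∷_) Sₙ)) + length (filter P? (map (false ∷_) Sₙ))
    ≡⟨ cong₂ _+_ (length-filter-map P? (true ∷_) Sₙ) (length-filter-map P? (false ∷_) Sₙ) ⟩
  countSubsets (P? ∘ (true ∷_)) + countSubsets (P? ∘ (false ∷_)) ∎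
  where
  open ≡-Reasoning
  Sₙ = allSubsets n

countSubsets-≐ : ∀ {n} {P Q : Pred (Subset n) 0ℓ} (P? : Decidable P) (Q? : Decidable Q) →
  P ≐ Q → countSubsets P? ≡ countSubsets Q?
countSubsets-≐ {n} P? Q? P≐Q = cong length (filter-≐ P? Q? P≐Q (allSubsets n))

countSubsets-none : ∀ {n} {P : Pred (Subset n) 0ℓ} (P? : Decidable P) →
  (∀ S → ¬ P S) → countSubsets P? ≡ 0
countSubsets-none {n} P? ¬P = cong length (filter-none P? (universal ¬P (allSubsets n)))

edgeℕ? : ∀ n a b → Dec (edgeℕ n a b)
edgeℕ? n a b = (suc a ≟ b ×-dec suc b ≤? n ∸ 1) ⊎-dec (a ≟ n ∸ 3 ×-dec b ≟ n ∸ 1)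

Adj? : ∀ n u v → Dec (Adj n u v)
Adj? n u v = edgeℕ? n (toℕ u) (toℕ v) ⊎-dec edgeℕ? n (toℕ v) (toℕ u)

-- Exhaustive search over pairs of vertices; the base cases n = 3, 4 below are evaluated with it.
independent? : ∀ n → Decidable (Independent n)
independent? n S = all? λ u → all? λ v → u ∈? S →-dec v ∈? S →-dec ¬? (Adj? n u v)

IndependentOfSize : ∀ n → ℕ → Pred (Subset n) 0ℓ
IndependentOfSize n k S = Independent n S × ∣ S ∣ ≡ k

independentOfSize? : ∀ n k → Decidable (IndependentOfSize n k)
independentOfSize? n k S = independent? n S ×-dec ∣ S ∣ ≟ k

numIndependent : ℕ → ℕ → ℕ
numIndependent n k = countSubsets (independentOfSize? n k)

-- Vertex 0 is s₁, the end of the long arm; deleting it from Γ_{D(4+m)} leaves Γ_{D(3+m)}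
-- shifted by one.
edge-suc⁺ : ∀ m a b → edgeℕ (3 + m) a b → edgeℕ (4 + m) (suc a) (suc b)
edge-suc⁺ m a b (inj₁ (refl , b<)) = inj₁ (refl , s≤s b<)
edge-suc⁺ m a b (inj₂ (refl , refl)) = inj₂ (refl , refl)

edge-suc⁻ : ∀ m a b → edgeℕ (4 + m) (suc a) (suc b) → edgeℕ (3 + m) a b
edge-suc⁻ m a b (inj₁ (refl , s≤s b<)) = inj₁ (refl , b<)
edge-suc⁻ m a b (inj₂ (refl , refl)) = inj₂ (refl , refl)

edge-from-0 : ∀ m b → edgeℕ (4 + m) 0 b → b ≡ 1
edge-from-0 m b (inj₁ (refl , _)) = refl
edge-from-0 m b (inj₂ (() , _))

edge-to-0 : ∀ m a → ¬ edgeℕ (4 + m) a 0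
edge-to-0 m a (inj₁ (() , _))
edge-to-0 m a (inj₂ (_ , ()))

Adj-sym : ∀ {n} {u v : Fin n} → Adj n u v → Adj n v u
Adj-sym (inj₁ e) = inj₂ e
Adj-sym (inj₂ e) = inj₁ e

Adj-suc⁺ : ∀ m {u v : Fin (3 + m)} → Adj (3 + m) u v → Adj (4 + m) (suc u) (suc v)
Adj-suc⁺ m (inj₁ e) = inj₁ (edge-suc⁺ m _ _ e)
Adj-suc⁺ m (inj₂ e) = inj₂ (edge-suc⁺ m _ _ e)

Adj-suc⁻ : ∀ m {u v : Fin (3 + m)} → Adj (4 + m) (suc u) (suc v) → Adj (3 + m) u v
Adj-suc⁻ m (inj₁ e) = inj₁ (edge-suc⁻ m _ _ e)
Adj-suc⁻ m (inj₂ e) = inj₂ (edge-suc⁻ m _ _ e)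

Adj-zero : ∀ m {v : Fin (4 + m)} → Adj (4 + m) zero v → v ≡ suc zero
Adj-zero m {v} (inj₁ e) = toℕ-injective (edge-from-0 m (toℕ v) e)
Adj-zero m {v} (inj₂ e) = ⊥-elim (edge-to-0 m (toℕ v) e)

Adj-zero-one : ∀ m → Adj (4 + m) zero (suc zero)
Adj-zero-one m = inj₁ (inj₁ (refl , s≤s (s≤s z≤n)))

Independent-∷⁻ : ∀ m {x} {S : Subset (3 + m)} → Independent (4 + m) (x ∷ S) → Independent (3 + m) S
Independent-∷⁻ m I u v u∈S v∈S adj = I (suc u) (suc v) (there u∈S) (there v∈S) (Adj-suc⁺ m adj)

Independent⇒¬s₁s₂ : ∀ m {T : Subset (4 + m)} → Independent (4 + m) T → ¬ (zero ∈ T × suc zero ∈ T)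
Independent⇒¬s₁s₂ m I (0∈T , 1∈T) = I zero (suc zero) 0∈T 1∈T (Adj-zero-one m)

Independent-∷⁺ : ∀ m {x} {S : Subset (3 + m)} → Independent (3 + m) S →
  ¬ (zero ∈ x ∷ S × suc zero ∈ x ∷ S) → Independent (4 + m) (x ∷ S)
Independent-∷⁺ m I ¬s₁s₂ zero v 0∈T v∈T adj with Adj-zero m adj
... | refl = ¬s₁s₂ (0∈T , v∈T)
Independent-∷⁺ m I ¬s₁s₂ (suc u) zero u∈T 0∈T adj with Adj-zero m (Adj-sym adj)
... | refl = ¬s₁s₂ (0∈T , u∈T)
Independent-∷⁺ m I ¬s₁s₂ (suc u) (suc v) (there u∈S) (there v∈S) adj = I u v u∈S v∈S (Adj-suc⁻ m adj)

iCount≡numIndependent : ∀ n k (dec : Decidable (IndependentOfSize n k)) → iCount n k dec ≡ numIndependent n k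
iCount≡numIndependent n k dec = countSubsets-≐ dec (independentOfSize? n k) ((λ p → p) , (λ p → p))

IndependentOfSize-false∷ : ∀ m k → (IndependentOfSize (4 + m) k ∘ (false ∷_)) ≐ IndependentOfSize (3 + m) k
IndependentOfSize-false∷ m k =
  (λ (I , size) → Independent-∷⁻ m I , size) ,
  (λ (I , size) → Independent-∷⁺ m I (λ { (() , _) }) , size)

IndependentOfSize-true∷false∷ : ∀ m k →
  (IndependentOfSize (5 + m) (suc k) ∘ (true ∷_) ∘ (false ∷_)) ≐ IndependentOfSize (3 + m) k
IndependentOfSize-true∷false∷ m k =
  (λ (I , size) → Independent-∷⁻ m (Independent-∷⁻ (suc m) I) , suc-injective size) ,
  (λ (I , size) → Independent-∷⁺ (suc m) (Independent-∷⁺ m I (λ { (() , _) })) (λ { (_ , there ()) })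
                  , cong suc size)

numIndependent-∷ : ∀ m k →
  numIndependent (4 + m) k ≡ countSubsets (independentOfSize? (4 + m) k ∘ (true ∷_)) + numIndependent (3 + m) k
numIndependent-∷ m k = trans (countSubsets-∷ (independentOfSize? (4 + m) k))
  (cong₂ _+_ refl (countSubsets-≐ _ (independentOfSize? (3 + m) k) (IndependentOfSize-false∷ m k)))

numIndependent-zero : ∀ m → numIndependent (5 + m) 0 ≡ numIndependent (4 + m) 0
numIndependent-zero m = trans (numIndependent-∷ (suc m) 0)
  (cong (_+ numIndependent (4 + m) 0) (countSubsets-none (independentOfSize? (5 + m) 0 ∘ (true ∷_)) λ _ ()))

numIndependent-suc : ∀ m k →
  numIndependent (5 + m) (suc k) ≡ numIndependent (3 + m) k + numIndependent (4 + m) (suc k)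
numIndependent-suc m k = begin
  numIndependent (5 + m) (suc k)
    ≡⟨ numIndependent-∷ (suc m) (suc k) ⟩
  countSubsets (P? ∘ (true ∷_)) + numIndependent (4 + m) (suc k)
    ≡⟨ cong (_+ numIndependent (4 + m) (suc k)) (countSubsets-∷ (P? ∘ (true ∷_))) ⟩
  countSubsets (P? ∘ (true ∷_) ∘ (true ∷_)) + countSubsets (P? ∘ (true ∷_) ∘ (false ∷_))
    + numIndependent (4 + m) (suc k)
    ≡⟨ cong (_+ numIndependent (4 + m) (suc k)) (cong₂ _+_ s₁s₂ s₁¬s₂) ⟩
  0 + numIndependent (3 + m) k + numIndependent (4 + m) (suc k) ∎
  where
  open ≡-Reasoning
  P? = independentOfSize? (5 + m) (suc k)
  s₁s₂ : countSubsets (P? ∘ (true ∷_) ∘ (true ∷_)) ≡ 0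
  s₁s₂ = countSubsets-none (P? ∘ (true ∷_) ∘ (true ∷_))
           λ _ (I , _) → Independent⇒¬s₁s₂ (suc m) I (here , there here)
  s₁¬s₂ : countSubsets (P? ∘ (true ∷_) ∘ (false ∷_)) ≡ numIndependent (3 + m) k
  s₁¬s₂ = countSubsets-≐ _ (independentOfSize? (3 + m) k) (IndependentOfSize-true∷false∷ m k)

-- Pascal's rule fails for binomℤ only at C(0,0) = 1 ≠ C(-1,-1) + C(-1,0).
binomℤ-pascal : ∀ a b → ¬ (a ≡ -[1+ 0 ] × b ≡ -[1+ 0 ]) →
  binomℤ (sucℤ a) (sucℤ b) ≡ binomℤ a b + binomℤ a (sucℤ b)
binomℤ-pascal (+ n)           (+ k)           _ = sym (nCk+nC[k+1]≡[n+1]C[k+1] n k)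
binomℤ-pascal (+ n)           -[1+ 0 ]        _ = refl
binomℤ-pascal (+ n)           -[1+ suc k ]    _ = refl
binomℤ-pascal -[1+ 0 ]        (+ k)           _ = refl
binomℤ-pascal -[1+ 0 ]        -[1+ 0 ]        ¬deg = ⊥-elim (¬deg (refl , refl))
binomℤ-pascal -[1+ 0 ]        -[1+ suc k ]    _ = refl
binomℤ-pascal -[1+ suc n ]    _               _ = refl

binomℤ-pascal′ : ∀ {a b a₁ a₂ b₁} → a₂ ≡ sucℤ a → a₁ ≡ a → b₁ ≡ sucℤ b →
  ¬ (a ≡ -[1+ 0 ] × b ≡ -[1+ 0 ]) → binomℤ a₂ b₁ ≡ binomℤ a b + binomℤ a₁ b₁
binomℤ-pascal′ refl refl refl = binomℤ-pascal _ _

sucℤ-minus : ∀ a c → (1ℤ +ℤ a) - c ≡ 1ℤ +ℤ (a - c)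
sucℤ-minus = solve-∀

sucℤ-minus-sucℤ : ∀ a c → (1ℤ +ℤ a) - (1ℤ +ℤ c) ≡ a - c
sucℤ-minus-sucℤ = solve-∀

sucℤ²-minus-sucℤ : ∀ a c → sucℤ (sucℤ a) - sucℤ c ≡ sucℤ (a - c)
sucℤ²-minus-sucℤ a c = trans (sucℤ-minus (sucℤ a) (sucℤ c)) (cong sucℤ (sucℤ-minus-sucℤ a c))

iFormula : ℕ → ℕ → ℕ
iFormula n k = binomℤ (+ n - + k) (+ k - + 2) + binomℤ (+ n - + k - + 1) (+ k - + 1) + binomℤ (+ n - + k) (+ k)

iFormula-suc : ∀ m k → iFormula (5 + m) (suc k) ≡ iFormula (3 + m) k + iFormula (4 + m) (suc k)
iFormula-suc m k =
  trans (cong₂ _+_ (cong₂ _+_ pascal₁ pascal₂) pascal₃) (+-interchange₃ t₁ u₁ t₂ u₂ t₃ u₃)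
  where
  n = + (3 + m)
  κ = + k
  t₁ = binomℤ (n - κ) (κ - + 2)
  t₂ = binomℤ (n - κ - + 1) (κ - + 1)
  t₃ = binomℤ (n - κ) κ
  u₁ = binomℤ (+ (4 + m) - + suc k) (+ suc k - + 2)
  u₂ = binomℤ (+ (4 + m) - + suc k - + 1) (+ suc k - + 1)
  u₃ = binomℤ (+ (4 + m) - + suc k) (+ suc k)

  pascal₁ : binomℤ (+ (5 + m) - + suc k) (+ suc k - + 2) ≡ t₁ + u₁
  pascal₁ = binomℤ-pascal′ (sucℤ²-minus-sucℤ n κ) (sucℤ-minus-sucℤ n κ) (sucℤ-minus κ (+ 2)) (nondeg k)
    where
    nondeg : ∀ k → ¬ (+ (3 + m) - + k ≡ -[1+ 0 ] × + k - + 2 ≡ -[1+ 0 ])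
    nondeg 0 (_ , ())
    nondeg 1 (() , _)
    nondeg (suc (suc k)) (_ , ())

  pascal₂ : binomℤ (+ (5 + m) - + suc k - + 1) (+ suc k - + 1) ≡ t₂ + u₂
  pascal₂ = binomℤ-pascal′ (trans (cong (_- + 1) (sucℤ²-minus-sucℤ n κ)) (sucℤ-minus (n - κ) (+ 1)))
              (cong (_- + 1) (sucℤ-minus-sucℤ n κ)) (sucℤ-minus κ (+ 1)) (nondeg k)
    where
    nondeg : ∀ k → ¬ (+ (3 + m) - + k - + 1 ≡ -[1+ 0 ] × + k - + 1 ≡ -[1+ 0 ])
    nondeg 0 (() , _)
    nondeg (suc k) (_ , ())

  pascal₃ : binomℤ (+ (5 + m) - + suc k) (+ suc k) ≡ t₃ + u₃
  pascal₃ = binomℤ-pascal′ (sucℤ²-minus-sucℤ n κ) (sucℤ-minus-sucℤ n κ) refl λ ()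

  +-interchange₃ : ∀ a₁ b₁ a₂ b₂ a₃ b₃ → (a₁ + b₁) + (a₂ + b₂) + (a₃ + b₃) ≡ (a₁ + a₂ + a₃) + (b₁ + b₂ + b₃)
  +-interchange₃ = ℕ-Solver.solve-∀

numIndependent≡iFormula : ∀ m k → numIndependent (3 + m) k ≡ iFormula (3 + m) k
numIndependent≡iFormula 0 0 = refl
numIndependent≡iFormula 0 1 = refl
numIndependent≡iFormula 0 2 = refl
numIndependent≡iFormula 0 3 = refl
numIndependent≡iFormula 0 (suc (suc (suc (suc k)))) = refl
numIndependent≡iFormula 1 0 = refl
numIndependent≡iFormula 1 1 = refl
numIndependent≡iFormula 1 2 = refl
numIndependent≡iFormula 1 3 = refl
numIndependent≡iFormula 1 4 = refl
numIndependent≡iFormula 1 (suc (suc (suc (suc (suc k))))) = refl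
numIndependent≡iFormula (suc (suc m)) zero =
  trans (numIndependent-zero m) (numIndependent≡iFormula (suc m) zero)
numIndependent≡iFormula (suc (suc m)) (suc k) =
  trans (numIndependent-suc m k)
    (trans (cong₂ _+_ (numIndependent≡iFormula m k) (numIndependent≡iFormula (suc m) (suc k)))
      (sym (iFormula-suc m k)))

lemma3p14 : (n k : ℕ) → 4 ≤ n →
    (dec : (S : Subset n) → Dec (Independent n S × ∣ S ∣ ≡ k)) →
    iCount n k dec ≡
      binomℤ (+ n - + k) (+ k - + 2) + binomℤ (+ n - + k - + 1) (+ k - + 1) + binomℤ (+ n - + k) (+ k)
lemma3p14 (suc (suc (suc n))) k _ dec = trans (iCount≡numIndependent (3 + n) k dec) (numIndependent≡iFormula n k)
lemma3p14 0 k () dec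
lemma3p14 1 k (s≤s ()) dec
lemma3p14 2 k (s≤s (s≤s ())) dec
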